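{- Let $n \geq 6$ be an even integer and let $r$ be a positive integer. Suppose $Q_{n-2}$ can be decomposed into cycles $C_1, C_2, \dots, C_s$, each of length $r(n-2)$ (so that $s = 2^{n-3}/r$), such that each $C_i$ contains $r$ edges $e_{i1}, e_{i2}, \dots, e_{ir}$ whose removal from $C_i$ leaves $r$ vertex-disjoint paths of length $n-3$, and such that the set $\{e_{ij} : j = 1, \dots, r;\ i = 1, \dots, s\}$ is a perfect matching of $Q_{n-2}$. Then $Q_n$ can be decomposed into cycles $Z_1, Z_2, \dots, Z_{4s}$, each of length $rn$, such that each $Z_i$ contains $r$ edges $f_{i1}, f_{i2}, \dots, f_{ir}$ whose removal from $Z_i$ leaves $r$ vertex-disjoint paths of length $n-1$, and such that the set $\{f_{ij} : j = 1, \dots, r;\ i = 1, \dots, 4s\}$ is a perfect matching of $Q_n$.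
   Context: $Q_k$ is the $k$-dimensional hypercube (vertices: binary $k$-tuples; edges: pairs differing in exactly one coordinate). A decomposition into cycles is a partition of the edge set into edge sets of cycles. Lengths are numbers of edges. A perfect matching is a set of pairwise vertex-disjoint edges covering every vertex. -}

module Defs where

open import Data.Bool using (Bool)
open import Data.Nat using (ℕ; zero; suc; _*_; _≤_; _∸_)
open import Data.Nat.DivMod using (_mod_)
open import Data.Fin using (Fin; toℕ; inject₁) renaming (suc to fsuc)
open import Data.Vec using (Vec; lookup)
open import Data.Product using (Σ; _×_; _,_; ∃)
open import Data.Sum using (_⊎_)
open import Relation.Binary.PropositionalEquality using (_≡_)
open import Relation.Nullary using (¬_)
open import Function.Definitions using (Injective)

Vertex : ℕ → Set
Vertex k = Vec Bool k

Adjacent : ∀ {k} → Vertex k → Vertex k → Set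
Adjacent {k} u v =
  Σ (Fin k) λ i → (¬ lookup u i ≡ lookup v i) × (∀ j → ¬ j ≡ i → lookup u j ≡ lookup v j)

-- An edge is written as a pair of endpoints; edges are unordered, so two
-- pairs denote the same edge iff they agree up to swapping.
Pair : ℕ → Set
Pair k = Vertex k × Vertex k

SameEdge : ∀ {k} → Pair k → Pair k → Set
SameEdge (u , v) (u' , v') = (u ≡ u' × v ≡ v') ⊎ (u ≡ v' × v ≡ u')

Incident : ∀ {k} → Vertex k → Pair k → Set
Incident w (u , v) = (w ≡ u) ⊎ (w ≡ v)

csuc : ∀ {L} → Fin L → Fin L
csuc {suc m} i = suc (toℕ i) mod suc m

record Cycle (k L : ℕ) : Set where
  field
    len≥3    : 3 ≤ L
    vtx      : Fin L → Vertex k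
    distinct : Injective _≡_ _≡_ vtx
    adj      : ∀ i → Adjacent (vtx i) (vtx (csuc i))

  edgeAt : Fin L → Pair k
  edgeAt i = vtx i , vtx (csuc i)

open Cycle public

record Path (k ℓ : ℕ) : Set where
  field
    pvtx      : Fin (suc ℓ) → Vertex k
    pdistinct : Injective _≡_ _≡_ pvtx
    padj      : ∀ (q : Fin ℓ) → Adjacent (pvtx (inject₁ q)) (pvtx (fsuc q))

  pedge : Fin ℓ → Pair k
  pedge q = pvtx (inject₁ q) , pvtx (fsuc q)

open Path public

IsDecomposition : ∀ {k L s} → (Fin s → Cycle k L) → Set
IsDecomposition {k} {L} {s} C =
  ∀ (u v : Vertex k) → Adjacent u v →
    (Σ (Fin s) λ i → Σ (Fin L) λ p → SameEdge (edgeAt (C i) p) (u , v))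
    × (∀ i i' p p' → SameEdge (edgeAt (C i) p) (u , v) →
         SameEdge (edgeAt (C i') p') (u , v) → (i ≡ i' × p ≡ p'))

IsPerfectMatching : ∀ {k} {I : Set} → (I → Pair k) → Set
IsPerfectMatching {k} {I} e =
  (∀ (w : Vertex k) → Σ I λ a → Incident w (e a))
  × (∀ a b (w : Vertex k) → Incident w (e a) → Incident w (e b) → SameEdge (e a) (e b))

-- Removing the marked edges (positions mk j, j = 1..r) from the cycle C
-- leaves r pairwise vertex-disjoint paths of length ℓ: there are r such
-- paths whose edge set is exactly the set of unmarked edges of C.
LeavesPaths : ∀ {k L r} → Cycle k L → (Fin r → Fin L) → ℕ → Set
LeavesPaths {k} {L} {r} C mk ℓ =
  Σ (Fin r → Path k ℓ) λ P →
    (∀ j j' → ¬ j ≡ j' → ∀ a b → ¬ pvtx (P j) a ≡ pvtx (P j') b)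
    × (∀ (p : Fin L) → (∀ j → ¬ mk j ≡ p) →
         Σ (Fin r) λ j → Σ (Fin ℓ) λ q → SameEdge (edgeAt C p) (pedge (P j) q))
    × (∀ j (q : Fin ℓ) →
         Σ (Fin L) λ p → (∀ j' → ¬ mk j' ≡ p) × SameEdge (edgeAt C p) (pedge (P j) q))

GoodDecomposition : (k r s : ℕ) → Set
GoodDecomposition k r s =
  Σ (Fin s → Cycle k (r * k)) λ C →
  Σ (Fin s → Fin r → Fin (r * k)) λ mk →
    IsDecomposition C
    × (∀ i → Injective _≡_ _≡_ (mk i))
    × (∀ i → LeavesPaths (C i) (mk i) (k ∸ 1))
    × IsPerfectMatching {k} {Fin s × Fin r} (λ { (i , j) → edgeAt (C i) (mk i j) })

-- Split Q_n = Q₂ × Q_{n-2} into four layers, ordered around the 4-cycle Q₂ by next. For each given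
-- cycle C and layer a, the cycle Z walks C in layer a but replaces every marked edge uv by the detour
-- (a,u) (a',u) (a',v) (a,v) with a' = next a, which adds 2r edges and gives length rn. Its marked edges
-- are the crossed copies in layer a'; removing them leaves every old path, run in layer a and extended
-- by the vertical edges at its two ends (which are ends of marked edges). A horizontal edge of Q_n lies
-- on exactly one Z: an unmarked edge of C in layer a on the Z of (C, a), a marked one on the Z of
-- (C, prev a). The vertical edges at x lie on the Z's of the cycle whose marked edge covers x. The new
-- marked edges are the old perfect matching copied into every layer, hence again a perfect matching.

module Submission where

open import Defs
open import Data.Nat using (ℕ; _≤_; _*_; _∸_)
open import Data.Nat.Divisibility using (_∣_)
open import Data.Nat as ℕ using (zero; suc; _+_; _<_; z≤n; s≤s; s≤s⁻¹; _<?_; _≟_)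
open import Data.Nat.Properties
  using ( <-irrefl; ≤-refl; ≤-trans; ≤-reflexive; n≤1+n; n<1+n; m≤n+m; m<n⇒m<1+n; ≤∧≢⇒<; m≤n⇒∃[o]m+o≡n
        ; +-identityʳ; +-suc; <⇒≤; ≮⇒≥; <⇒≱; <-≤-trans; +-0-commutativeMonoid )
open import Data.Nat.DivMod using (_mod_; _%_; m%n<n; m<n⇒m%n≡m; n%n≡0; %-distribˡ-+; m%n%n≡m%n)
open import Data.Nat.Tactic.RingSolver using (solve-∀)
open import Algebra.Properties.CommutativeMonoid.Sum +-0-commutativeMonoid using (sum; sum-cong-≗; ∑-distrib-+)
open import Data.Bool using (Bool; true; false; not)
open import Data.Bool.Properties using (¬-not)
open import Data.Fin as Fin using (Fin; toℕ; fromℕ; fromℕ<; inject₁; combine; remQuot)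
open import Data.Fin.Patterns using (0F; 1F; 2F; 3F)
open import Data.Fin.Properties
  using ( toℕ-injective; toℕ-fromℕ<; toℕ<n; toℕ-fromℕ; toℕ-inject₁; fromℕ≢inject₁; any?
        ; remQuot-combine; combine-remQuot )
import Data.Fin.Properties as Finₚ
open import Data.Fin.Relation.Unary.Top using (View; view; ‵fromℕ; ‵inject₁; view-inject₁; view-fromℕ)
open import Data.Vec using (_∷_; lookup; tabulate)
open import Data.Vec.Properties using (tabulate∘lookup; tabulate-cong; ∷-injective)
open import Data.Product using (Σ; ∃; _×_; _,_; proj₁; proj₂; uncurry)
open import Data.Sum using (_⊎_; inj₁; inj₂)
open import Data.Empty using (⊥-elim)
open import Function using (_∘_)
open import Function.Definitions using (Injective)
open import Relation.Binary.PropositionalEquality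
open import Relation.Nullary using (¬_; Dec; yes; no; contradiction)

vertex-ext : ∀ {k} {x y : Vertex k} → (∀ i → lookup x i ≡ lookup y i) → x ≡ y
vertex-ext {x = x} {y} x≗y = begin
  x                   ≡⟨ tabulate∘lookup x ⟨
  tabulate (lookup x) ≡⟨ tabulate-cong x≗y ⟩
  tabulate (lookup y) ≡⟨ tabulate∘lookup y ⟩
  y                   ∎
  where open ≡-Reasoning

Adjacent-irrefl : ∀ {k} {u v : Vertex k} → Adjacent u v → u ≢ v
Adjacent-irrefl (_ , ui≢vi , _) refl = ui≢vi refl

Adjacent-sym : ∀ {k} {u v : Vertex k} → Adjacent u v → Adjacent v u
Adjacent-sym (i , ui≢vi , rest) = i , ui≢vi ∘ sym , λ j j≢i → sym (rest j j≢i)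

Adjacent-∷ : ∀ {k} b {x y : Vertex k} → Adjacent x y → Adjacent (b ∷ x) (b ∷ y)
Adjacent-∷ b (i , xi≢yi , rest) = Fin.suc i , xi≢yi , λ
  { Fin.zero _ → refl
  ; (Fin.suc j) j≢i → rest j (j≢i ∘ cong Fin.suc) }

Adjacent-flip : ∀ {k b c} (x : Vertex k) → b ≢ c → Adjacent (b ∷ x) (c ∷ x)
Adjacent-flip x b≢c = Fin.zero , b≢c , λ
  { Fin.zero 0≢0 → contradiction refl 0≢0
  ; (Fin.suc j) _ → refl }

Adjacent-∷⁻ : ∀ {k b c} {x y : Vertex k} → Adjacent (b ∷ x) (c ∷ y) →
              (b ≡ c × Adjacent x y) ⊎ (b ≢ c × x ≡ y)
Adjacent-∷⁻ (Fin.zero , b≢c , rest) = inj₂ (b≢c , vertex-ext λ j → rest (Fin.suc j) λ ())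
Adjacent-∷⁻ (Fin.suc i , xi≢yi , rest) =
  inj₁ (rest Fin.zero (λ ()) , i , xi≢yi , λ j j≢i → rest (Fin.suc j) (j≢i ∘ Finₚ.suc-injective))

SameEdge-refl : ∀ {k} {e : Pair k} → SameEdge e e
SameEdge-refl = inj₁ (refl , refl)

SameEdge-swap : ∀ {k} {u v : Vertex k} → SameEdge (u , v) (v , u)
SameEdge-swap = inj₂ (refl , refl)

SameEdge-sym : ∀ {k} {e e' : Pair k} → SameEdge e e' → SameEdge e' e
SameEdge-sym (inj₁ (refl , refl)) = SameEdge-refl
SameEdge-sym (inj₂ (refl , refl)) = SameEdge-swap

SameEdge-trans : ∀ {k} {e e' e'' : Pair k} → SameEdge e e' → SameEdge e' e'' → SameEdge e e''
SameEdge-trans (inj₁ (refl , refl)) same = same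
SameEdge-trans (inj₂ (refl , refl)) (inj₁ (refl , refl)) = SameEdge-swap
SameEdge-trans (inj₂ (refl , refl)) (inj₂ (refl , refl)) = SameEdge-refl

Incident-resp-SameEdge : ∀ {k} {w : Vertex k} {e e' : Pair k} → Incident w e → SameEdge e e' → Incident w e'
Incident-resp-SameEdge (inj₁ refl) (inj₁ (refl , refl)) = inj₁ refl
Incident-resp-SameEdge (inj₂ refl) (inj₁ (refl , refl)) = inj₂ refl
Incident-resp-SameEdge (inj₁ refl) (inj₂ (refl , refl)) = inj₂ refl
Incident-resp-SameEdge (inj₂ refl) (inj₂ (refl , refl)) = inj₁ refl

module CyclicSuccessor (L' : ℕ) where

  private
    L : ℕ
    L = suc L'

  toℕ-mod : ∀ p → toℕ (p mod L) ≡ p % L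
  toℕ-mod p = toℕ-fromℕ< (m%n<n p L)

  toℕ-mod-< : ∀ {p} → p < L → toℕ (p mod L) ≡ p
  toℕ-mod-< {p} p<L = trans (toℕ-mod p) (m<n⇒m%n≡m p<L)

  toℕ-mod-toℕ : (P : Fin L) → toℕ P mod L ≡ P
  toℕ-mod-toℕ P = toℕ-injective (toℕ-mod-< (toℕ<n P))

  mod-self : L mod L ≡ Fin.zero
  mod-self = toℕ-injective (trans (toℕ-mod L) (n%n≡0 L))

  csuc-mod : ∀ p → csuc (p mod L) ≡ suc p mod L
  csuc-mod p = toℕ-injective (begin
    toℕ (csuc (p mod L))    ≡⟨ toℕ-mod (suc (toℕ (p mod L))) ⟩
    suc (toℕ (p mod L)) % L ≡⟨ cong (λ t → suc t % L) (toℕ-mod p) ⟩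
    (1 + p % L) % L         ≡⟨ %-distribˡ-+ 1 (p % L) L ⟩
    (1 % L + p % L % L) % L ≡⟨ cong (λ t → (1 % L + t) % L) (m%n%n≡m%n p L) ⟩
    (1 % L + p % L) % L     ≡⟨ %-distribˡ-+ 1 p L ⟨
    suc p % L               ≡⟨ toℕ-mod (suc p) ⟨
    toℕ (suc p mod L)       ∎)
    where open ≡-Reasoning

  csuc-fromℕ : csuc (fromℕ L') ≡ Fin.zero
  csuc-fromℕ = toℕ-injective (trans (toℕ-mod (suc (toℕ (fromℕ L'))))
                                    (trans (cong (λ t → suc t % L) (toℕ-fromℕ L')) (n%n≡0 L)))

  csuc-inject₁ : (P : Fin L') → csuc (inject₁ P) ≡ Fin.suc P
  csuc-inject₁ P = toℕ-injective (trans (toℕ-mod (suc (toℕ (inject₁ P))))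
    (trans (cong (λ t → suc t % L) (toℕ-inject₁ P)) (m<n⇒m%n≡m (s≤s (toℕ<n P)))))

  cpred : Fin L → Fin L
  cpred Fin.zero = fromℕ L'
  cpred (Fin.suc P) = inject₁ P

  csuc-cpred : (P : Fin L) → csuc (cpred P) ≡ P
  csuc-cpred Fin.zero = csuc-fromℕ
  csuc-cpred (Fin.suc P) = csuc-inject₁ P

  cpred-csuc : (P : Fin L) → cpred (csuc P) ≡ P
  cpred-csuc P with view P
  ... | ‵fromℕ = cong cpred csuc-fromℕ
  ... | ‵inject₁ Q = cong cpred (csuc-inject₁ Q)

  csuc-injective : ∀ {P P' : Fin L} → csuc P ≡ csuc P' → P ≡ P'
  csuc-injective {P} {P'} eq = trans (sym (cpred-csuc P)) (trans (cong cpred eq) (cpred-csuc P'))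

  toℕ-csuc : ∀ P → toℕ (csuc P) ≡ suc (toℕ P) ⊎ (suc (toℕ P) ≡ L × csuc P ≡ Fin.zero)
  toℕ-csuc P with view P
  ... | ‵fromℕ     = inj₂ (cong suc (toℕ-fromℕ L') , csuc-fromℕ)
  ... | ‵inject₁ Q = inj₁ (trans (cong toℕ (csuc-inject₁ Q)) (cong suc (sym (toℕ-inject₁ Q))))

Layer : Set
Layer = Fin 4

high low : Layer → Bool
high 0F = false
high 1F = false
high 2F = true
high 3F = true
low 0F = false
low 1F = true
low 2F = true
low 3F = false

layerOf : Bool → Bool → Layer
layerOf false false = 0F
layerOf false true  = 1F
layerOf true  true  = 2F
layerOf true  false = 3F

layerOf-high-low : ∀ a → layerOf (high a) (low a) ≡ a
layerOf-high-low 0F = refl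
layerOf-high-low 1F = refl
layerOf-high-low 2F = refl
layerOf-high-low 3F = refl

next prev : Layer → Layer
next 0F = 1F
next 1F = 2F
next 2F = 3F
next 3F = 0F
prev 0F = 3F
prev 1F = 0F
prev 2F = 1F
prev 3F = 2F

next-prev : ∀ a → next (prev a) ≡ a
next-prev 0F = refl
next-prev 1F = refl
next-prev 2F = refl
next-prev 3F = refl

prev-next : ∀ a → prev (next a) ≡ a
prev-next 0F = refl
prev-next 1F = refl
prev-next 2F = refl
prev-next 3F = refl

next-injective : ∀ {a a'} → next a ≡ next a' → a ≡ a'
next-injective {a} {a'} eq = trans (sym (prev-next a)) (trans (cong prev eq) (prev-next a'))

next-≢ : ∀ a → a ≢ next a
next-≢ 0F ()
next-≢ 1F ()
next-≢ 2F ()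
next-≢ 3F ()

next-next-≢ : ∀ a → next (next a) ≢ a
next-next-≢ 0F ()
next-next-≢ 1F ()
next-next-≢ 2F ()
next-next-≢ 3F ()

layer : ∀ {m} → Layer → Vertex m → Vertex (suc (suc m))
layer a x = high a ∷ low a ∷ x

layer-injective : ∀ {m} {a a' : Layer} {x y : Vertex m} → layer a x ≡ layer a' y → a ≡ a' × x ≡ y
layer-injective {a = a} {a'} eq with ∷-injective eq
... | high≡ , rest with ∷-injective rest
... | low≡ , x≡y = trans (sym (layerOf-high-low a)) (trans (cong₂ layerOf high≡ low≡) (layerOf-high-low a')) , x≡y

layer-adjacent : ∀ {m} a {x y : Vertex m} → Adjacent x y → Adjacent (layer a x) (layer a y)
layer-adjacent a = Adjacent-∷ (high a) ∘ Adjacent-∷ (low a)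

layer-next-adjacent : ∀ {m} a (x : Vertex m) → Adjacent (layer a x) (layer (next a) x)
layer-next-adjacent 0F x = Adjacent-∷ false (Adjacent-flip x λ ())
layer-next-adjacent 1F x = Adjacent-flip (true ∷ x) λ ()
layer-next-adjacent 2F x = Adjacent-∷ true (Adjacent-flip x λ ())
layer-next-adjacent 3F x = Adjacent-flip (false ∷ x) λ ()

layer-layerOf : ∀ {m} b c (x : Vertex m) → layer (layerOf b c) x ≡ b ∷ c ∷ x
layer-layerOf false false x = refl
layer-layerOf false true  x = refl
layer-layerOf true  true  x = refl
layer-layerOf true  false x = refl

data LayeredEdge {m} : Vertex (suc (suc m)) → Vertex (suc (suc m)) → Set where
  horizontal : ∀ a {x y} → Adjacent x y → LayeredEdge (layer a x) (layer a y)
  rising     : ∀ a x → LayeredEdge (layer a x) (layer (next a) x)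
  falling    : ∀ a x → LayeredEdge (layer (next a) x) (layer a x)

layeredEdge : ∀ {m} {u v : Vertex (suc (suc m))} → Adjacent u v → LayeredEdge u v
layeredEdge {u = b ∷ c ∷ x} {b' ∷ c' ∷ y} adj with Adjacent-∷⁻ adj
... | inj₂ (b≢b' , cx≡c'y) with ∷-injective cx≡c'y | ¬-not (b≢b' ∘ sym)
...   | refl , refl | refl = flipHigh b c x
  where
  flipHigh : ∀ b c x → LayeredEdge (b ∷ c ∷ x) (not b ∷ c ∷ x)
  flipHigh false false x = falling 3F x
  flipHigh false true  x = rising 1F x
  flipHigh true  false x = rising 3F x
  flipHigh true  true  x = falling 1F x
layeredEdge {u = b ∷ c ∷ x} {b' ∷ c' ∷ y} adj | inj₁ (refl , adj') with Adjacent-∷⁻ adj'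
... | inj₁ (refl , adj'') = subst₂ LayeredEdge (layer-layerOf b c x) (layer-layerOf b c y) (horizontal (layerOf b c) adj'')
... | inj₂ (c≢c' , refl) with ¬-not (c≢c' ∘ sym)
...   | refl = flipLow b c y
  where
  flipLow : ∀ b c x → LayeredEdge (b ∷ c ∷ x) (b ∷ not c ∷ x)
  flipLow false false x = rising 0F x
  flipLow false true  x = falling 0F x
  flipLow true  false x = falling 2F x
  flipLow true  true  x = rising 2F x

SameEdge-layer : ∀ {m} a {x y x' y' : Vertex m} → SameEdge (x , y) (x' , y') →
                 SameEdge (layer a x , layer a y) (layer a x' , layer a y')
SameEdge-layer a (inj₁ (refl , refl)) = inj₁ (refl , refl)
SameEdge-layer a (inj₂ (refl , refl)) = inj₂ (refl , refl)

SameEdge-layer⁻ : ∀ {m} {b c b' c' : Layer} {x y x' y' : Vertex m} →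
  SameEdge (layer b x , layer c y) (layer b' x' , layer c' y') →
  ((b ≡ b' × x ≡ x') × (c ≡ c' × y ≡ y')) ⊎ ((b ≡ c' × x ≡ y') × (c ≡ b' × y ≡ x'))
SameEdge-layer⁻ (inj₁ (eq₁ , eq₂)) = inj₁ (layer-injective eq₁ , layer-injective eq₂)
SameEdge-layer⁻ (inj₂ (eq₁ , eq₂)) = inj₂ (layer-injective eq₁ , layer-injective eq₂)

SameEdge-layer-injective : ∀ {m} {b b' : Layer} {x y x' y' : Vertex m} →
  SameEdge (layer b x , layer b y) (layer b' x' , layer b' y') → b ≡ b' × SameEdge (x , y) (x' , y')
SameEdge-layer-injective same with SameEdge-layer⁻ same
... | inj₁ ((b≡b' , x≡x') , (_ , y≡y')) = b≡b' , inj₁ (x≡x' , y≡y')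
... | inj₂ ((b≡b' , x≡y') , (_ , y≡x')) = b≡b' , inj₂ (x≡y' , y≡x')

Incident-layer : ∀ {m} a {x y₁ y₂ : Vertex m} → Incident x (y₁ , y₂) →
                 Incident (layer a x) (layer a y₁ , layer a y₂)
Incident-layer a (inj₁ refl) = inj₁ refl
Incident-layer a (inj₂ refl) = inj₂ refl

Incident-layer⁻ : ∀ {m} a {w} {y₁ y₂ : Vertex m} → Incident w (layer a y₁ , layer a y₂) →
                  Σ (Vertex m) λ x → w ≡ layer a x × Incident x (y₁ , y₂)
Incident-layer⁻ a {y₁ = y₁} (inj₁ refl) = y₁ , refl , inj₁ refl
Incident-layer⁻ a {y₂ = y₂} (inj₂ refl) = y₂ , refl , inj₂ refl

indicator : ∀ {p} {P : Set p} → Dec P → ℕ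
indicator (yes _) = 1
indicator (no _)  = 0

∑-indicator-all : ∀ {r} {Q : Fin r → Set} (Q? : ∀ j → Dec (Q j)) → (∀ j → Q j) → sum (indicator ∘ Q?) ≡ r
∑-indicator-all {zero} Q? all = refl
∑-indicator-all {suc r} Q? all with Q? Fin.zero
... | yes _ = cong suc (∑-indicator-all (Q? ∘ Fin.suc) (all ∘ Fin.suc))
... | no ¬q = contradiction (all Fin.zero) ¬q

∑-indicator-unique : ∀ {r} {Q : Fin r → Set} (Q? : ∀ j → Dec (Q j)) → (∀ j j' → Q j → Q j' → j ≡ j') →
                     (∃Q? : Dec (∃ Q)) → sum (indicator ∘ Q?) ≡ indicator ∃Q?
∑-indicator-unique {zero} Q? unique (yes (() , _))
∑-indicator-unique {zero} Q? unique (no _) = refl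
∑-indicator-unique {suc r} {Q} Q? unique = split (Q? Fin.zero)
  where
  rest : (d : Dec (∃ (Q ∘ Fin.suc))) → sum (indicator ∘ Q? ∘ Fin.suc) ≡ indicator d
  rest = ∑-indicator-unique (Q? ∘ Fin.suc) λ j j' q q' → Finₚ.suc-injective (unique _ _ q q')
  split : (d₀ : Dec (Q Fin.zero)) (d : Dec (∃ Q)) → indicator d₀ + sum (indicator ∘ Q? ∘ Fin.suc) ≡ indicator d
  split (yes q₀) (yes _) = cong suc (rest (no λ (j , q) → Finₚ.0≢1+n (unique _ _ q₀ q)))
  split (yes q₀) (no ¬∃) = contradiction (Fin.zero , q₀) ¬∃
  split (no ¬q₀) (yes (Fin.zero , q₀)) = contradiction q₀ ¬q₀
  split (no _) (yes (Fin.suc j , q)) = rest (yes (j , q))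
  split (no _) (no ¬∃) = rest (no λ (j , q) → ¬∃ (Fin.suc j , q))

indicator-<-suc : ∀ x p → indicator (x <? suc p) ≡ indicator (x <? p) + indicator (x ≟ p)
indicator-<-suc x p with x <? suc p | x <? p | x ≟ p
... | yes _   | yes x<p | yes refl = contradiction x<p (<-irrefl refl)
... | yes _   | yes _   | no _     = refl
... | yes _   | no _    | yes _    = refl
... | yes x<1+p | no x≮p | no x≢p  = contradiction (≤∧≢⇒< (s≤s⁻¹ x<1+p) x≢p) x≮p
... | no x≮1+p | yes x<p | _       = contradiction (m<n⇒m<1+n x<p) x≮1+p
... | no x≮1+p | no _   | yes refl = contradiction (n<1+n x) x≮1+p
... | no _    | no _    | no _     = refl

data Phase : Set where
  ground lifted crossed : Phase

State : Set
State = ℕ × Phase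

-- A walk along a cycle with some positions marked: at an unmarked position p it stays in its layer and
-- takes cycle edge p; at a marked one it rises to the next layer, crosses edge p there and falls back.
-- State (p , φ) is the walk at cycle position p in phase φ; rank p is the step at which (p , ground) is reached.
module Detour {Marked : ℕ → Set} (marked? : ∀ p → Dec (Marked p)) where

  leave : ∀ p → Dec (Marked p) → State
  leave p (yes _) = p , lifted
  leave p (no _)  = suc p , ground

  step : State → State
  step (p , ground)  = leave p (marked? p)
  step (p , lifted)  = p , crossed
  step (p , crossed) = suc p , ground

  decode : ℕ → State
  decode zero    = 0 , ground
  decode (suc q) = step (decode q)

  data Leg : State → Set where
    stay  : ∀ {p} → ¬ Marked p → Leg (p , ground)
    rise  : ∀ {p} → Marked p → Leg (p , ground)
    cross : ∀ {p} → Marked p → Leg (p , lifted)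
    fall  : ∀ {p} → Marked p → Leg (p , crossed)

  width : ∀ {p} → Dec (Marked p) → ℕ
  width (yes _) = 3
  width (no _)  = 1

  rank : ℕ → ℕ
  rank zero    = zero
  rank (suc p) = width (marked? p) + rank p

  offset : Phase → ℕ
  offset ground  = 0
  offset lifted  = 1
  offset crossed = 2

  position : State → ℕ
  position (p , φ) = offset φ + rank p

  step-stay : ∀ {p} → ¬ Marked p → step (p , ground) ≡ (suc p , ground)
  step-stay {p} ¬m with marked? p
  ... | yes m = contradiction m ¬m
  ... | no _  = refl

  step-rise : ∀ {p} → Marked p → step (p , ground) ≡ (p , lifted)
  step-rise {p} m with marked? p
  ... | yes _  = refl
  ... | no ¬m = contradiction m ¬m

  rank-stay : ∀ {p} → ¬ Marked p → rank (suc p) ≡ suc (rank p)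
  rank-stay {p} ¬m with marked? p
  ... | yes m = contradiction m ¬m
  ... | no _  = refl

  rank-rise : ∀ {p} → Marked p → rank (suc p) ≡ 3 + rank p
  rank-rise {p} m with marked? p
  ... | yes _  = refl
  ... | no ¬m = contradiction m ¬m

  ground-leg : ∀ p → Leg (p , ground)
  ground-leg p with marked? p
  ... | yes m = rise m
  ... | no ¬m = stay ¬m

  step-leg : ∀ {x} → Leg x → Leg (step x) × position (step x) ≡ suc (position x)
  step-leg (stay {p} ¬m) rewrite step-stay ¬m = ground-leg (suc p) , rank-stay ¬m
  step-leg (rise m) rewrite step-rise m = cross m , refl
  step-leg (cross m) = fall m , refl
  step-leg (fall {p} m) = ground-leg (suc p) , rank-rise m

  decode-leg : ∀ q → Leg (decode q) × position (decode q) ≡ q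
  decode-leg zero = ground-leg 0 , refl
  decode-leg (suc q) with decode-leg q
  ... | leg , pos≡q = proj₁ (step-leg leg) , trans (proj₂ (step-leg leg)) (cong suc pos≡q)

  decode-rank : ∀ p → decode (rank p) ≡ (p , ground)
  decode-rank zero = refl
  decode-rank (suc p) with marked? p
  ... | yes m = trans (cong (step ∘ step ∘ step) (decode-rank p)) (cong (step ∘ step) (step-rise m))
  ... | no ¬m = trans (cong step (decode-rank p)) (step-stay ¬m)

  rank-<-suc : ∀ p → rank p < rank (suc p)
  rank-<-suc p with marked? p
  ... | yes _ = m≤n+m (suc (rank p)) 2
  ... | no _  = n<1+n (rank p)

  rank-mono-≤ : ∀ {p p'} → p ≤ p' → rank p ≤ rank p'
  rank-mono-≤ {p} {p'} p≤p' with m≤n⇒∃[o]m+o≡n p≤p'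
  ... | d , refl = go d
    where
    go : ∀ d → rank p ≤ rank (p + d)
    go zero    = ≤-reflexive (cong rank (sym (+-identityʳ p)))
    go (suc d) = ≤-trans (go d) (subst (λ t → rank (p + d) ≤ rank t) (sym (+-suc p d)) (<⇒≤ (rank-<-suc (p + d))))

  decode-position : ∀ {x} → Leg x → decode (position x) ≡ x
  decode-position (stay {p} _) = decode-rank p
  decode-position (rise {p} _) = decode-rank p
  decode-position (cross {p} m) = trans (cong step (decode-rank p)) (step-rise m)
  decode-position (fall {p} m) = cong step (trans (cong step (decode-rank p)) (step-rise m))

  position-<-rank-suc : ∀ {x} → Leg x → position x < rank (suc (proj₁ x))
  position-<-rank-suc (stay {p} _) = rank-<-suc p
  position-<-rank-suc (rise {p} _) = rank-<-suc p
  position-<-rank-suc (cross {p} m) = subst (suc (rank p) <_) (sym (rank-rise m)) (m≤n+m _ 1)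
  position-<-rank-suc (fall {p} m) = subst (2 + rank p <_) (sym (rank-rise m)) ≤-refl

  position-< : ∀ {x L} → Leg x → proj₁ x < L → position x < rank L
  position-< leg p<L = <-≤-trans (position-<-rank-suc leg) (rank-mono-≤ p<L)

  decode-< : ∀ {q L} → q < rank L → proj₁ (decode q) < L
  decode-< {q} {L} q<rankL with decode-leg q
  ... | _ , pos≡q with decode q
  ... | p , φ with p <? L
  ... | yes p<L = p<L
  ... | no p≮L = contradiction
    (≤-trans (rank-mono-≤ (≮⇒≥ p≮L)) (subst (rank p ≤_) pos≡q (m≤n+m (rank p) (offset φ))))
                               (<⇒≱ q<rankL)

module InjectiveMarking {r L} (mk : Fin r → Fin L) (mk-injective : Injective _≡_ _≡_ mk) where

  Marked : ℕ → Set
  Marked p = ∃ λ j → toℕ (mk j) ≡ p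

  marked? : ∀ p → Dec (Marked p)
  marked? p = any? λ j → toℕ (mk j) ≟ p

  open Detour marked? public

  count : ℕ → ℕ
  count p = sum λ j → indicator (toℕ (mk j) <? p)

  count-suc : ∀ p → count (suc p) ≡ count p + indicator (marked? p)
  count-suc p = begin
    count (suc p)                                           ≡⟨ sum-cong-≗ (λ j → indicator-<-suc (toℕ (mk j)) p) ⟩
    sum (λ j → indicator (toℕ (mk j) <? p) + indicator (toℕ (mk j) ≟ p))
      ≡⟨ ∑-distrib-+ (λ j → indicator (toℕ (mk j) <? p)) (λ j → indicator (toℕ (mk j) ≟ p)) ⟩
    count p + sum (λ j → indicator (toℕ (mk j) ≟ p))
      ≡⟨ cong (count p +_) (∑-indicator-unique _ unique (marked? p)) ⟩
    count p + indicator (marked? p)                         ∎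
    where
    open ≡-Reasoning
    unique : ∀ j j' → toℕ (mk j) ≡ p → toℕ (mk j') ≡ p → j ≡ j'
    unique j j' eq eq' = mk-injective (toℕ-injective (trans eq (sym eq')))

  rank-count : ∀ p → rank p ≡ p + 2 * count p
  rank-count zero = cong (2 *_) (sym (∑-indicator-unique (λ j → toℕ (mk j) <? 0) (λ _ _ ()) (no λ ())))
  rank-count (suc p) = begin
    width (marked? p) + rank p                          ≡⟨ cong₂ _+_ (width-indicator (marked? p)) (rank-count p) ⟩
    (1 + 2 * indicator (marked? p)) + (p + 2 * count p) ≡⟨ rearrange (indicator (marked? p)) p (count p) ⟩
    suc p + 2 * (count p + indicator (marked? p))       ≡⟨ cong (λ c → suc p + 2 * c) (count-suc p) ⟨
    suc p + 2 * count (suc p)                           ∎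
    where
    open ≡-Reasoning
    width-indicator : (d : Dec (Marked p)) → width d ≡ 1 + 2 * indicator d
    width-indicator (yes _) = refl
    width-indicator (no _)  = refl
    rearrange : ∀ i p c → (1 + 2 * i) + (p + 2 * c) ≡ suc p + 2 * (c + i)
    rearrange = solve-∀

  rank-total : rank L ≡ L + 2 * r
  rank-total = trans (rank-count L) (cong (λ c → L + 2 * c) (∑-indicator-all _ λ j → toℕ<n (mk j)))

data Boundary {n} : Fin (suc (suc n)) → Set where
  start : Boundary Fin.zero
  inner : (u : Fin n) → Boundary (Fin.suc (inject₁ u))
  end   : Boundary (Fin.suc (fromℕ n))

boundaryAfterStart : ∀ {n} {t : Fin (suc n)} → View t → Boundary (Fin.suc t)
boundaryAfterStart ‵fromℕ = end
boundaryAfterStart (‵inject₁ u) = inner u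

boundary : ∀ {n} (x : Fin (suc (suc n))) → Boundary x
boundary Fin.zero = start
boundary (Fin.suc t) = boundaryAfterStart (view t)

boundary-unique : ∀ {n} {x : Fin (suc (suc n))} (b : Boundary x) → boundary x ≡ b
boundary-unique start = refl
boundary-unique (inner u) = cong boundaryAfterStart (view-inject₁ u)
boundary-unique end = cong boundaryAfterStart (view-fromℕ _)

module LiftedPath {m ℓ} (a : Layer) (p : Path m (suc ℓ)) where

  private
    first last : Vertex m
    first = pvtx p Fin.zero
    last  = pvtx p (fromℕ (suc ℓ))

  levelAt : ∀ {x : Fin (suc (suc (suc (suc ℓ))))} → Boundary x → Layer
  levelAt (inner _) = a
  levelAt start = next a
  levelAt end = next a

  baseAt : ∀ {x : Fin (suc (suc (suc (suc ℓ))))} → Boundary x → Fin (suc (suc ℓ))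
  baseAt start = Fin.zero
  baseAt (inner u) = u
  baseAt end = fromℕ (suc ℓ)

  liftedVertex : Fin (suc (suc (suc (suc ℓ)))) → Vertex (suc (suc m))
  liftedVertex x = layer (levelAt (boundary x)) (pvtx p (baseAt (boundary x)))

  liftedVertex-at : ∀ {x} (b : Boundary x) → liftedVertex x ≡ layer (levelAt b) (pvtx p (baseAt b))
  liftedVertex-at b = cong (λ b → layer (levelAt b) (pvtx p (baseAt b))) (boundary-unique b)

  boundary-injective : ∀ {x x'} (b : Boundary x) (b' : Boundary x') →
                       levelAt b ≡ levelAt b' → baseAt b ≡ baseAt b' → x ≡ x'
  boundary-injective start     start      _ _ = refl
  boundary-injective start     (inner _)  level≡ _ = contradiction (sym level≡) (next-≢ a)
  boundary-injective start     end        _ ()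
  boundary-injective (inner _) start      level≡ _ = contradiction level≡ (next-≢ a)
  boundary-injective (inner _) (inner _)  _ refl = refl
  boundary-injective (inner _) end        level≡ _ = contradiction level≡ (next-≢ a)
  boundary-injective end       start      _ ()
  boundary-injective end       (inner _)  level≡ _ = contradiction (sym level≡) (next-≢ a)
  boundary-injective end       end        _ _ = refl

  liftedVertex-injective : Injective _≡_ _≡_ liftedVertex
  liftedVertex-injective {x} {x'} eq with layer-injective eq
  ... | level≡ , base≡ = boundary-injective (boundary x) (boundary x') level≡ (pdistinct p base≡)

  liftedEdge : ∀ {q : Fin (suc (suc (suc ℓ)))} → Boundary q → Pair (suc (suc m))
  liftedEdge start     = layer (next a) first , layer a first
  liftedEdge (inner u) = layer a (pvtx p (inject₁ u)) , layer a (pvtx p (Fin.suc u))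
  liftedEdge end       = layer a last , layer (next a) last

  liftedEdge-adjacent : ∀ {q} (b : Boundary q) → Adjacent (proj₁ (liftedEdge b)) (proj₂ (liftedEdge b))
  liftedEdge-adjacent start     = Adjacent-sym {u = layer a first} {layer (next a) first} (layer-next-adjacent a first)
  liftedEdge-adjacent (inner u) = layer-adjacent a (padj p u)
  liftedEdge-adjacent end       = layer-next-adjacent a last

  liftedVertex-edge : ∀ {q} (b : Boundary q) → (liftedVertex (inject₁ q) , liftedVertex (Fin.suc q)) ≡ liftedEdge b
  liftedVertex-edge start     = cong (layer (next a) first ,_) (liftedVertex-at (inner Fin.zero))
  liftedVertex-edge (inner u) = cong₂ _,_ (liftedVertex-at (inner (inject₁ u))) (liftedVertex-at (inner (Fin.suc u)))
  liftedVertex-edge end       = cong₂ _,_ (liftedVertex-at (inner (fromℕ (suc ℓ)))) (liftedVertex-at end)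

  liftedPath : Path (suc (suc m)) (suc (suc (suc ℓ)))
  liftedPath = record
    { pvtx      = liftedVertex
    ; pdistinct = liftedVertex-injective
    ; padj      = λ q → subst (λ e → Adjacent (proj₁ e) (proj₂ e)) (sym (liftedVertex-edge (boundary q)))
                                (liftedEdge-adjacent (boundary q))
    }

inject₁≢suc : ∀ {n} {u v : Fin n} → toℕ u ≤ toℕ v → inject₁ u ≢ Fin.suc v
inject₁≢suc {u = u} {v} u≤v eq = <-irrefl (trans (sym (toℕ-inject₁ u)) (cong toℕ eq)) (s≤s u≤v)

module MarkedCycle {k L' r ℓ} (C : Cycle k (suc L')) (mk : Fin r → Fin (suc L'))
  (edge-unique : ∀ O O' → SameEdge (edgeAt C O) (edgeAt C O') → O ≡ O')
  (marked-disjoint : ∀ j j' w → Incident w (edgeAt C (mk j)) → Incident w (edgeAt C (mk j')) → mk j ≡ mk j')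
  (leaves : LeavesPaths C mk (suc ℓ)) where

  open CyclicSuccessor L'

  P : Fin r → Path k (suc ℓ)
  P = proj₁ leaves

  paths-disjoint : ∀ j j' → ¬ j ≡ j' → ∀ a b → ¬ pvtx (P j) a ≡ pvtx (P j') b
  paths-disjoint = proj₁ (proj₂ leaves)

  unmarked⇒on-path : ∀ O → (∀ j → ¬ mk j ≡ O) →
                     Σ (Fin r) λ j → Σ (Fin (suc ℓ)) λ t → SameEdge (edgeAt C O) (pedge (P j) t)
  unmarked⇒on-path = proj₁ (proj₂ (proj₂ leaves))

  on-path⇒unmarked : ∀ j t → Σ (Fin (suc L')) λ O → (∀ j' → ¬ mk j' ≡ O) × SameEdge (edgeAt C O) (pedge (P j) t)
  on-path⇒unmarked = proj₂ (proj₂ (proj₂ leaves))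

  first last : Fin r → Vertex k
  first j = pvtx (P j) Fin.zero
  last j  = pvtx (P j) (fromℕ (suc ℓ))

  Marked : Fin (suc L') → Set
  Marked O = ∃ λ j → mk j ≡ O

  marked? : ∀ O → Dec (Marked O)
  marked? O = any? λ j → mk j Finₚ.≟ O

  csuc-≢ : ∀ O → csuc O ≢ O
  csuc-≢ O eq = Adjacent-irrefl (adj C O) (cong (vtx C) (sym eq))

  incident-cycle-edge : ∀ {O O'} → Incident (vtx C O') (edgeAt C O) → O ≡ O' ⊎ csuc O ≡ O'
  incident-cycle-edge (inj₁ eq) = inj₁ (sym (distinct C eq))
  incident-cycle-edge (inj₂ eq) = inj₂ (sym (distinct C eq))

  incident-path-edge : ∀ {j j' a t} → Incident (pvtx (P j) a) (pedge (P j') t) →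
                       j' ≡ j × (a ≡ inject₁ t ⊎ a ≡ Fin.suc t)
  incident-path-edge {j} {j'} inc with j' Finₚ.≟ j
  incident-path-edge {j} {j'} (inj₁ eq) | yes refl = refl , inj₁ (pdistinct (P j) eq)
  incident-path-edge {j} {j'} (inj₂ eq) | yes refl = refl , inj₂ (pdistinct (P j) eq)
  incident-path-edge {j} {j'} (inj₁ eq) | no j'≢j = contradiction eq (paths-disjoint j j' (j'≢j ∘ sym) _ _)
  incident-path-edge {j} {j'} (inj₂ eq) | no j'≢j = contradiction eq (paths-disjoint j j' (j'≢j ∘ sym) _ _)

  OnlyPathEdge : Vertex k → Fin r → Fin (suc ℓ) → Set
  OnlyPathEdge y j t = ∀ j' t' → Incident y (pedge (P j') t') → j' ≡ j × t' ≡ t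

  first-only-on-first-edge : ∀ j → OnlyPathEdge (first j) j Fin.zero
  first-only-on-first-edge j j' t' inc with incident-path-edge inc
  ... | refl , inj₁ 0≡t' with t'
  ...   | Fin.zero = refl , refl
  first-only-on-first-edge j j' t' inc | refl , inj₂ ()

  last-only-on-last-edge : ∀ j → OnlyPathEdge (last j) j (fromℕ ℓ)
  last-only-on-last-edge j j' t' inc with incident-path-edge inc
  ... | refl , inj₁ last≡t' = contradiction last≡t' fromℕ≢inject₁
  ... | refl , inj₂ last≡t' = refl , sym (Finₚ.suc-injective last≡t')

  -- The other cycle edge at an end of a path cannot be a path edge, so it is marked.
  only-path-edge⇒marked : ∀ {y j t} O O' → OnlyPathEdge y j t → SameEdge (edgeAt C O) (pedge (P j) t) →
                          Incident y (edgeAt C O') → O' ≢ O → Marked O'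
  only-path-edge⇒marked O O' only O~t inc O'≢O with marked? O'
  ... | yes marked = marked
  ... | no unmarked with unmarked⇒on-path O' (λ j e → unmarked (j , e))
  ...   | j' , t' , O'~t' with only j' t' (Incident-resp-SameEdge inc O'~t')
  ...     | refl , refl = contradiction (edge-unique O' O (SameEdge-trans O'~t' (SameEdge-sym O~t))) O'≢O

  path-end⇒marked-end : ∀ {y j t} → Incident y (pedge (P j) t) → OnlyPathEdge y j t →
                        ∃ λ j₀ → Incident y (edgeAt C (mk j₀))
  path-end⇒marked-end {j = j} {t} inc only with on-path⇒unmarked j t
  ... | O , _ , O~t with Incident-resp-SameEdge inc (SameEdge-sym O~t)
  ...   | inj₁ refl with only-path-edge⇒marked O (cpred O) only O~t (inj₂ (cong (vtx C) (sym (csuc-cpred O))))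
                         (λ eq → csuc-≢ O (trans (cong csuc (sym eq)) (csuc-cpred O)))
  ...     | j₀ , mk≡cpred = j₀ , inj₂ (cong (vtx C) (sym (trans (cong csuc mk≡cpred) (csuc-cpred O))))
  path-end⇒marked-end {j = j} {t} inc only | O , _ , O~t | inj₂ refl
    with only-path-edge⇒marked O (csuc O) only O~t (inj₁ refl) (csuc-≢ O)
  ... | j₀ , mk≡csuc = j₀ , inj₁ (cong (vtx C) (sym mk≡csuc))

  first⇒marked-end : ∀ j → ∃ λ j₀ → Incident (first j) (edgeAt C (mk j₀))
  first⇒marked-end j = path-end⇒marked-end (inj₁ refl) (first-only-on-first-edge j)

  last⇒marked-end : ∀ j → ∃ λ j₀ → Incident (last j) (edgeAt C (mk j₀))
  last⇒marked-end j = path-end⇒marked-end (inj₂ refl) (last-only-on-last-edge j)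

  IsPathEnd : Vertex k → Set
  IsPathEnd w = ∃ λ j → w ≡ first j ⊎ w ≡ last j

  UniqueUnmarkedAt : Vertex k → Fin (suc L') → Set
  UniqueUnmarkedAt w O =
    Incident w (edgeAt C O) × ¬ Marked O × (∀ O' → Incident w (edgeAt C O') → ¬ Marked O' → O' ≡ O)

  -- The marked edges are vertex-disjoint, so the other cycle edge at an end of a marked edge is unmarked.
  unmarked-edge-at-marked-end : ∀ {j₀ w} → Incident w (edgeAt C (mk j₀)) → ∃ (UniqueUnmarkedAt w)
  unmarked-edge-at-marked-end {j₀} (inj₁ refl) =
    cpred (mk j₀) , inj₂ (cong (vtx C) (sym (csuc-cpred (mk j₀)))) , unmarked , unique
    where
    unmarked : ¬ Marked (cpred (mk j₀))
    unmarked (j₁ , mk≡cpred) with marked-disjoint j₀ j₁ _ (inj₁ refl)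
                                    (inj₂ (cong (vtx C) (sym (trans (cong csuc mk≡cpred) (csuc-cpred (mk j₀))))))
    ... | mk₀≡mk₁ = csuc-≢ (mk j₀) (trans (cong csuc (trans mk₀≡mk₁ mk≡cpred)) (csuc-cpred (mk j₀)))
    unique : ∀ O' → Incident (vtx C (mk j₀)) (edgeAt C O') → ¬ Marked O' → O' ≡ cpred (mk j₀)
    unique O' inc unmarked' with incident-cycle-edge inc
    ... | inj₁ O'≡mk = contradiction (j₀ , sym O'≡mk) unmarked'
    ... | inj₂ csuc≡mk = trans (sym (cpred-csuc O')) (cong cpred csuc≡mk)
  unmarked-edge-at-marked-end {j₀} (inj₂ refl) = csuc (mk j₀) , inj₁ refl , unmarked , unique
    where
    unmarked : ¬ Marked (csuc (mk j₀))
    unmarked (j₁ , mk≡csuc) with marked-disjoint j₀ j₁ _ (inj₂ refl) (inj₁ (cong (vtx C) (sym mk≡csuc)))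
    ... | mk₀≡mk₁ = csuc-≢ (mk j₀) (sym (trans mk₀≡mk₁ mk≡csuc))
    unique : ∀ O' → Incident (vtx C (csuc (mk j₀))) (edgeAt C O') → ¬ Marked O' → O' ≡ csuc (mk j₀)
    unique O' inc unmarked' with incident-cycle-edge inc
    ... | inj₁ O'≡csuc = O'≡csuc
    ... | inj₂ csuc≡csuc = contradiction (j₀ , sym (csuc-injective csuc≡csuc)) unmarked'

  -- An interior path vertex would carry two distinct unmarked cycle edges.
  unique-unmarked⇒path-end : ∀ {w O j a} → UniqueUnmarkedAt w O → w ≡ pvtx (P j) a → IsPathEnd w
  unique-unmarked⇒path-end {j = j} {a} (_ , _ , unique) w≡ with boundary a
  ... | start = j , inj₁ w≡
  ... | end = j , inj₂ w≡
  ... | inner u with on-path⇒unmarked j (inject₁ u) | on-path⇒unmarked j (Fin.suc u)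
  ...   | Oa , unmarkedA , Oa~ | Ob , unmarkedB , Ob~
    with unique Oa (Incident-resp-SameEdge (inj₂ w≡) (SameEdge-sym Oa~)) (λ (j' , e) → unmarkedA j' e)
       | unique Ob (Incident-resp-SameEdge (inj₁ w≡) (SameEdge-sym Ob~)) (λ (j' , e) → unmarkedB j' e)
  ...     | refl | refl with SameEdge-trans (SameEdge-sym Oa~) Ob~
  ...       | inj₁ (_ , eq) = ⊥-elim (inject₁≢suc ≤-refl (Finₚ.suc-injective (pdistinct (P j) eq)))
  ...       | inj₂ (eq , _) =
    ⊥-elim (inject₁≢suc (≤-trans (≤-reflexive (toℕ-inject₁ u)) (n≤1+n _)) (pdistinct (P j) eq))

  marked-end⇒path-end : ∀ {j₀ w} → Incident w (edgeAt C (mk j₀)) → IsPathEnd w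
  marked-end⇒path-end inc with unmarked-edge-at-marked-end inc
  ... | O , unique@(w∈O , unmarked , _) with unmarked⇒on-path O (λ j e → unmarked (j , e))
  ...   | j , t , O~t with Incident-resp-SameEdge w∈O O~t
  ...     | inj₁ w≡ = unique-unmarked⇒path-end unique w≡
  ...     | inj₂ w≡ = unique-unmarked⇒path-end unique w≡

module Reindexed {k L s t} (F : Fin s → Fin t → Cycle k L) where

  row : Fin (t * s) → Fin s
  row z = proj₂ (remQuot {t} s z)

  column : Fin (t * s) → Fin t
  column z = proj₁ (remQuot {t} s z)

  F′ : Fin (t * s) → Cycle k L
  F′ z = F (row z) (column z)

  F′-combine : ∀ a i → F′ (combine a i) ≡ F i a
  F′-combine a i = cong (λ ai → F (proj₂ ai) (proj₁ ai)) (remQuot-combine a i)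

  row-column-injective : ∀ {z z'} → row z ≡ row z' → column z ≡ column z' → z ≡ z'
  row-column-injective {z} {z'} row≡ column≡ =
    trans (sym (combine-remQuot {t} s z)) (trans (cong₂ combine column≡ row≡) (combine-remQuot {t} s z'))

  OnSomeCycle : Vertex k → Vertex k → Set
  OnSomeCycle u w = Σ (Fin s) λ i → Σ (Fin t) λ a → Σ (Fin L) λ q → SameEdge (edgeAt (F i a) q) (u , w)

  OnSomeCycle-swap : ∀ {u w} → OnSomeCycle u w → OnSomeCycle w u
  OnSomeCycle-swap (i , a , q , same) = i , a , q , SameEdge-trans same SameEdge-swap

  decomposition :
    (∀ u w → Adjacent u w → OnSomeCycle u w) →
    (∀ {i i' a a' q q'} → SameEdge (edgeAt (F i a) q) (edgeAt (F i' a') q') → i ≡ i' × a ≡ a' × q ≡ q') →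
    IsDecomposition F′
  decomposition covered unique u w adjacent = existence (covered u w adjacent) , uniqueness
    where
    existence : OnSomeCycle u w → Σ (Fin (t * s)) λ z → Σ (Fin L) λ q → SameEdge (edgeAt (F′ z) q) (u , w)
    existence (i , a , q , same) =
      combine a i , q , subst (λ Y → SameEdge (edgeAt Y q) (u , w)) (sym (F′-combine a i)) same
    uniqueness : ∀ z z' q q' → SameEdge (edgeAt (F′ z) q) (u , w) → SameEdge (edgeAt (F′ z') q') (u , w) →
                 z ≡ z' × q ≡ q'
    uniqueness z z' q q' same same' with unique (SameEdge-trans same (SameEdge-sym same'))
    ... | row≡ , column≡ , q≡q' = row-column-injective row≡ column≡ , q≡q'

  -- e is left abstract so that it can be instantiated with the pattern-matching lambda of GoodDecomposition.
  matching : ∀ {r} (mk : Fin s → Fin r → Fin L) (E : Fin s → Fin t → Fin r → Pair k) →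
    (∀ i a j → edgeAt (F i a) (mk i j) ≡ E i a j) →
    (∀ w → Σ (Fin s) λ i → Σ (Fin t) λ a → Σ (Fin r) λ j → Incident w (E i a j)) →
    (∀ {i a j i' a' j' w} → Incident w (E i a j) → Incident w (E i' a' j') → SameEdge (E i a j) (E i' a' j')) →
    (e : Fin (t * s) × Fin r → Pair k) → (∀ z j → e (z , j) ≡ edgeAt (F′ z) (mk (row z) j)) →
    IsPerfectMatching e
  matching {r} mk E F≡E covers unique e e≡ = cover , unique′
    where
    e≡E : ∀ z j → e (z , j) ≡ E (row z) (column z) j
    e≡E z j = trans (e≡ z j) (F≡E _ _ j)
    cover : ∀ w → Σ (Fin (t * s) × Fin r) λ zj → Incident w (e zj)
    cover w with covers w
    ... | i , a , j , inc = (combine a i , j) , subst (Incident w) (sym (trans (e≡E (combine a i) j)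
                              (cong (λ ai → E (proj₂ ai) (proj₁ ai) j) (remQuot-combine a i)))) inc
    unique′ : ∀ zj zj' w → Incident w (e zj) → Incident w (e zj') → SameEdge (e zj) (e zj')
    unique′ (z , j) (z' , j') w inc inc' = subst₂ SameEdge (sym (e≡E z j)) (sym (e≡E z' j'))
      (unique (subst (Incident w) (e≡E z j) inc) (subst (Incident w) (e≡E z' j') inc'))

module Lift {k r' s : ℕ}
  (C : Fin s → Cycle (suc (suc k)) (suc r' * suc (suc k)))
  (mk : Fin s → Fin (suc r') → Fin (suc r' * suc (suc k)))
  (decomposition : IsDecomposition C)
  (mk-injective : ∀ i → Injective _≡_ _≡_ (mk i))
  (leaves : ∀ i → LeavesPaths (C i) (mk i) (suc k))
  (matching : IsPerfectMatching {suc (suc k)} {Fin s × Fin (suc r')} (λ { (i , j) → edgeAt (C i) (mk i j) }))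
  where

  private
    m n r L Ln : ℕ
    m  = suc (suc k)
    n  = suc (suc m)
    r  = suc r'
    L  = r * m
    Ln = r * n

  module ModL  = CyclicSuccessor (ℕ.pred L)
  module ModLn = CyclicSuccessor (ℕ.pred Ln)

  cycle-edge-unique : ∀ {i i' O O'} → SameEdge (edgeAt (C i) O) (edgeAt (C i') O') → i ≡ i' × O ≡ O'
  cycle-edge-unique {i} {i'} {O} {O'} same = proj₂ (decomposition _ _ (adj (C i') O')) i i' O O' same SameEdge-refl

  marked-edges-disjoint : ∀ {i i' j j' w} → Incident w (edgeAt (C i) (mk i j)) →
                          Incident w (edgeAt (C i') (mk i' j')) → i ≡ i' × mk i j ≡ mk i' j'
  marked-edges-disjoint {i} {i'} {j} {j'} {w} inc inc' =
    cycle-edge-unique (proj₂ matching (i , j) (i' , j') w inc inc')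

  module Paths (i : Fin s) = MarkedCycle (C i) (mk i) (λ O O' → proj₂ ∘ cycle-edge-unique)
    (λ j j' w inc inc' → proj₂ (marked-edges-disjoint inc inc')) (leaves i)

  module Walk (i : Fin s) = InjectiveMarking (mk i) (mk-injective i)

  v : Fin s → ℕ → Vertex m
  v i p = vtx (C i) (p mod L)

  v-suc : ∀ i p → v i (suc p) ≡ vtx (C i) (csuc (p mod L))
  v-suc i p = cong (vtx (C i)) (sym (ModL.csuc-mod p))

  v-toℕ : ∀ i P → v i (toℕ P) ≡ vtx (C i) P
  v-toℕ i P = cong (vtx (C i)) (ModL.toℕ-mod-toℕ P)

  v-suc-toℕ : ∀ i P → v i (suc (toℕ P)) ≡ vtx (C i) (csuc P)
  v-suc-toℕ i P = trans (v-suc i (toℕ P)) (cong (vtx (C i) ∘ csuc) (ModL.toℕ-mod-toℕ P))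

  cycle-edge-mod : ∀ i p → edgeAt (C i) (p mod L) ≡ (v i p , v i (suc p))
  cycle-edge-mod i p = cong (v i p ,_) (sym (v-suc i p))

  cycle-edge-toℕ : ∀ i P → edgeAt (C i) P ≡ (v i (toℕ P) , v i (suc (toℕ P)))
  cycle-edge-toℕ i P = sym (cong₂ _,_ (v-toℕ i P) (v-suc-toℕ i P))

  v-adjacent : ∀ i p → Adjacent (v i p) (v i (suc p))
  v-adjacent i p = subst (Adjacent (v i p)) (sym (v-suc i p)) (adj (C i) (p mod L))

  mod-injective : ∀ {p p'} → p < L → p' < L → p mod L ≡ p' mod L → p ≡ p'
  mod-injective p<L p'<L eq = trans (sym (ModL.toℕ-mod-< p<L)) (trans (cong toℕ eq) (ModL.toℕ-mod-< p'<L))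

  v-injective : ∀ i {p p'} → p < L → p' < L → v i p ≡ v i p' → p ≡ p'
  v-injective i p<L p'<L = mod-injective p<L p'<L ∘ distinct (C i)

  v-suc-injective : ∀ i {p p'} → p < L → p' < L → v i (suc p) ≡ v i (suc p') → p ≡ p'
  v-suc-injective i {p} {p'} p<L p'<L eq =
    mod-injective p<L p'<L (ModL.csuc-injective (distinct (C i) (trans (sym (v-suc i p)) (trans eq (v-suc i p')))))

  v-marked : ∀ i {j p} → toℕ (mk i j) ≡ p → v i p ≡ vtx (C i) (mk i j)
  v-marked i {j} refl = v-toℕ i (mk i j)

  v-suc-marked : ∀ i {j p} → toℕ (mk i j) ≡ p → v i (suc p) ≡ vtx (C i) (csuc (mk i j))
  v-suc-marked i {j} refl = v-suc-toℕ i (mk i j)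

  unmarked-mod : ∀ i {p} → p < L → ¬ Walk.Marked i p → ∀ j → mk i j ≢ p mod L
  unmarked-mod i p<L ¬marked j eq = ¬marked (j , trans (cong toℕ eq) (ModL.toℕ-mod-< p<L))

  stateVertex : Fin s → Layer → State → Vertex n
  stateVertex i a (p , ground)  = layer a (v i p)
  stateVertex i a (p , lifted)  = layer (next a) (v i p)
  stateVertex i a (p , crossed) = layer (next a) (v i (suc p))

  stateEdge : Fin s → Layer → State → Pair n
  stateEdge i a x = stateVertex i a x , stateVertex i a (Walk.step i x)

  legEdge : ∀ i → Layer → ∀ {x} → Walk.Leg i x → Pair n
  legEdge i a (Walk.stay {p} _)  = layer a (v i p) , layer a (v i (suc p))
  legEdge i a (Walk.rise {p} _)  = layer a (v i p) , layer (next a) (v i p)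
  legEdge i a (Walk.cross {p} _) = layer (next a) (v i p) , layer (next a) (v i (suc p))
  legEdge i a (Walk.fall {p} _)  = layer (next a) (v i (suc p)) , layer a (v i (suc p))

  stateEdge-leg : ∀ i a {x} (leg : Walk.Leg i x) → stateEdge i a x ≡ legEdge i a leg
  stateEdge-leg i a (Walk.stay ¬m) rewrite Walk.step-stay i ¬m = refl
  stateEdge-leg i a (Walk.rise m) rewrite Walk.step-rise i m = refl
  stateEdge-leg i a (Walk.cross _) = refl
  stateEdge-leg i a (Walk.fall _) = refl

  legEdge-adjacent : ∀ i a {x} (leg : Walk.Leg i x) → Adjacent (proj₁ (legEdge i a leg)) (proj₂ (legEdge i a leg))
  legEdge-adjacent i a (Walk.stay {p} _)  = layer-adjacent a (v-adjacent i p)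
  legEdge-adjacent i a (Walk.rise {p} _)  = layer-next-adjacent a (v i p)
  legEdge-adjacent i a (Walk.cross {p} _) = layer-adjacent (next a) (v-adjacent i p)
  legEdge-adjacent i a (Walk.fall {p} _)  =
    Adjacent-sym {u = layer a (v i (suc p))} {layer (next a) (v i (suc p))} (layer-next-adjacent a (v i (suc p)))

  rank-L : ∀ i → Walk.rank i L ≡ Ln
  rank-L i = trans (Walk.rank-total i) (detour-length r m)
    where
    detour-length : ∀ r m → r * m + 2 * r ≡ r * (2 + m)
    detour-length = solve-∀

  stateAt : Fin s → Fin Ln → State
  stateAt i q = Walk.decode i (toℕ q)

  legAt : ∀ i q → Walk.Leg i (stateAt i q)
  legAt i q = proj₁ (Walk.decode-leg i (toℕ q))

  stateAt-< : ∀ i q → proj₁ (stateAt i q) < L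
  stateAt-< i q = Walk.decode-< i (subst (toℕ q <_) (sym (rank-L i)) (toℕ<n q))

  stateAt-injective : ∀ i {q q'} → stateAt i q ≡ stateAt i q' → q ≡ q'
  stateAt-injective i {q} {q'} eq =
    toℕ-injective (trans (sym (position-stateAt q)) (trans (cong (Walk.position i) eq) (position-stateAt q')))
    where
    position-stateAt : ∀ q → Walk.position i (stateAt i q) ≡ toℕ q
    position-stateAt q = proj₂ (Walk.decode-leg i (toℕ q))

  marked-ends-differ : ∀ i {p p'} → Walk.Marked i p → Walk.Marked i p' → v i p ≢ v i (suc p')
  marked-ends-differ i {p} {p'} (j , e) (j' , e') eq
    with marked-edges-disjoint (inj₁ (v-marked i e)) (inj₂ (trans eq (v-suc-marked i e')))
  ... | _ , mk≡mk' = Adjacent-irrefl (adj (C i) (mk i j))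
    (trans (sym (v-marked i e)) (trans eq (trans (v-suc-marked i e') (cong (vtx (C i) ∘ csuc) (sym mk≡mk')))))

  stateVertex-injective : ∀ i a {x x'} → Walk.Leg i x → Walk.Leg i x' → proj₁ x < L → proj₁ x' < L →
                          stateVertex i a x ≡ stateVertex i a x' → x ≡ x'
  stateVertex-injective i a {_ , ground}  {_ , ground}  _ _ p<L p'<L eq =
    cong (_, ground) (v-injective i p<L p'<L (proj₂ (layer-injective eq)))
  stateVertex-injective i a {_ , lifted}  {_ , lifted}  _ _ p<L p'<L eq =
    cong (_, lifted) (v-injective i p<L p'<L (proj₂ (layer-injective eq)))
  stateVertex-injective i a {_ , crossed} {_ , crossed} _ _ p<L p'<L eq =
    cong (_, crossed) (v-suc-injective i p<L p'<L (proj₂ (layer-injective eq)))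
  stateVertex-injective i a {_ , ground}  {_ , lifted}  _ _ _ _ eq = ⊥-elim (next-≢ a (proj₁ (layer-injective eq)))
  stateVertex-injective i a {_ , ground}  {_ , crossed} _ _ _ _ eq = ⊥-elim (next-≢ a (proj₁ (layer-injective eq)))
  stateVertex-injective i a {_ , lifted}  {_ , ground}  _ _ _ _ eq = ⊥-elim (next-≢ a (sym (proj₁ (layer-injective eq))))
  stateVertex-injective i a {_ , crossed} {_ , ground}  _ _ _ _ eq = ⊥-elim (next-≢ a (sym (proj₁ (layer-injective eq))))
  stateVertex-injective i a {_ , lifted}  {_ , crossed} (Walk.cross m) (Walk.fall m') _ _ eq =
    ⊥-elim (marked-ends-differ i m m' (proj₂ (layer-injective eq)))
  stateVertex-injective i a {_ , crossed} {_ , lifted}  (Walk.fall m) (Walk.cross m') _ _ eq =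
    ⊥-elim (marked-ends-differ i m' m (sym (proj₂ (layer-injective eq))))

  Zvtx : Fin s → Layer → Fin Ln → Vertex n
  Zvtx i a q = stateVertex i a (stateAt i q)

  Zvtx-injective : ∀ i a → Injective _≡_ _≡_ (Zvtx i a)
  Zvtx-injective i a {q} {q'} eq = stateAt-injective i
    (stateVertex-injective i a (legAt i q) (legAt i q') (stateAt-< i q) (stateAt-< i q') eq)

  -- Past the last position the state is (L , ground), whose vertex v L is v 0 again.
  Zvtx-csuc : ∀ i a q → Zvtx i a (csuc q) ≡ stateVertex i a (Walk.step i (stateAt i q))
  Zvtx-csuc i a q with ModLn.toℕ-csuc q
  ... | inj₁ toℕ-csuc = cong (stateVertex i a ∘ Walk.decode i) toℕ-csuc
  ... | inj₂ (suc-q≡Ln , csuc≡0) = begin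
    Zvtx i a (csuc q)                               ≡⟨ cong (Zvtx i a) csuc≡0 ⟩
    layer a (vtx (C i) Fin.zero)                    ≡⟨ cong (layer a ∘ vtx (C i)) ModL.mod-self ⟨
    stateVertex i a (L , ground)                    ≡⟨ cong (stateVertex i a) (Walk.decode-rank i L) ⟨
    stateVertex i a (Walk.decode i (Walk.rank i L)) ≡⟨ cong (stateVertex i a ∘ Walk.decode i) (trans (rank-L i) (sym suc-q≡Ln)) ⟩
    stateVertex i a (Walk.step i (stateAt i q))     ∎
    where open ≡-Reasoning

  Z : Fin s → Layer → Cycle n Ln
  Z i a = record
    { len≥3    = s≤s (s≤s (s≤s z≤n))
    ; vtx      = Zvtx i a
    ; distinct = Zvtx-injective i a
    ; adj      = λ q → subst (Adjacent (Zvtx i a q)) (sym (Zvtx-csuc i a q))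
                          (subst (λ e → Adjacent (proj₁ e) (proj₂ e)) (sym (stateEdge-leg i a (legAt i q)))
                                 (legEdge-adjacent i a (legAt i q)))
    }

  Z-edge : ∀ i a q → edgeAt (Z i a) q ≡ legEdge i a (legAt i q)
  Z-edge i a q = trans (cong (Zvtx i a q ,_) (Zvtx-csuc i a q)) (stateEdge-leg i a (legAt i q))

  position<Ln : ∀ i {x} → Walk.Leg i x → proj₁ x < L → Walk.position i x < Ln
  position<Ln i {x} leg p<L = subst (Walk.position i x <_) (rank-L i) (Walk.position-< i leg p<L)

  slot : ∀ i {x} → Walk.Leg i x → proj₁ x < L → Fin Ln
  slot i {x} leg p<L = fromℕ< (position<Ln i leg p<L)

  stateAt-slot : ∀ i {x} (leg : Walk.Leg i x) p<L → stateAt i (slot i leg p<L) ≡ x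
  stateAt-slot i leg p<L = trans (cong (Walk.decode i) (toℕ-fromℕ< (position<Ln i leg p<L))) (Walk.decode-position i leg)

  edge-at-slot : ∀ i a {x} (leg : Walk.Leg i x) p<L → edgeAt (Z i a) (slot i leg p<L) ≡ legEdge i a leg
  edge-at-slot i a leg p<L = trans (cong (Zvtx i a (slot i leg p<L) ,_) (Zvtx-csuc i a (slot i leg p<L)))
    (trans (cong (stateEdge i a) (stateAt-slot i leg p<L)) (stateEdge-leg i a leg))

  module Indexed = Reindexed Z

  open Indexed using (OnSomeCycle; OnSomeCycle-swap)

  at-leg : ∀ i a {x} (leg : Walk.Leg i x) p<L {e} → SameEdge (legEdge i a leg) e →
           Σ (Fin Ln) λ q → SameEdge (edgeAt (Z i a) q) e
  at-leg i a leg p<L same = slot i leg p<L , subst (λ e → SameEdge e _) (sym (edge-at-slot i a leg p<L)) same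

  horizontal-covered : ∀ α {x y} → Adjacent x y → OnSomeCycle (layer α x) (layer α y)
  horizontal-covered α {x} {y} adjacent = covered (proj₁ (decomposition x y adjacent))
    where
    covered : (Σ (Fin s) λ i → Σ (Fin L) λ P → SameEdge (edgeAt (C i) P) (x , y)) → OnSomeCycle (layer α x) (layer α y)
    covered (i , P , same) = by-marking (Walk.marked? i (toℕ P))
      where
      lifted-same : ∀ b → SameEdge (layer b (v i (toℕ P)) , layer b (v i (suc (toℕ P)))) (layer b x , layer b y)
      lifted-same b = SameEdge-layer b (subst (λ e → SameEdge e (x , y)) (cycle-edge-toℕ i P) same)
      by-marking : Dec (Walk.Marked i (toℕ P)) → OnSomeCycle (layer α x) (layer α y)
      by-marking (no ¬m) = i , α , at-leg i α (Walk.stay ¬m) (toℕ<n P) (lifted-same α)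
      by-marking (yes m) = i , prev α , at-leg i (prev α) (Walk.cross m) (toℕ<n P)
        (subst (λ b → SameEdge (layer b (v i (toℕ P)) , layer b (v i (suc (toℕ P)))) (layer α x , layer α y))
               (sym (next-prev α)) (lifted-same α))

  vertical-covered : ∀ a x → OnSomeCycle (layer a x) (layer (next a) x)
  vertical-covered a x with proj₁ matching x
  ... | (i , j) , inj₁ refl = i , a , at-leg i a (Walk.rise (j , refl)) (toℕ<n (mk i j))
    (subst (λ y → SameEdge (layer a y , layer (next a) y) (layer a x , layer (next a) x))
           (sym (v-toℕ i (mk i j))) SameEdge-refl)
  ... | (i , j) , inj₂ refl = i , a , at-leg i a (Walk.fall (j , refl)) (toℕ<n (mk i j))
    (subst (λ y → SameEdge (layer (next a) y , layer a y) (layer a x , layer (next a) x))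
           (sym (v-suc-toℕ i (mk i j))) SameEdge-swap)

  edge-covered : ∀ u w → Adjacent u w → OnSomeCycle u w
  edge-covered u w adjacent with layeredEdge {u = u} {w} adjacent
  ... | horizontal α adj = horizontal-covered α adj
  ... | rising a x = vertical-covered a x
  ... | falling a x = OnSomeCycle-swap (vertical-covered a x)

  horizontal-unique : ∀ {i i' p p' b b'} → p < L → p' < L →
    SameEdge (layer b (v i p) , layer b (v i (suc p))) (layer b' (v i' p') , layer b' (v i' (suc p'))) →
    i ≡ i' × p ≡ p' × b ≡ b'
  horizontal-unique {i} {i'} {p} {p'} p<L p'<L same =
    let b≡b' , base-same = SameEdge-layer-injective same
        i≡i' , P≡P' = cycle-edge-unique (subst₂ SameEdge (sym (cycle-edge-mod i p)) (sym (cycle-edge-mod i' p')) base-same)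
    in i≡i' , mod-injective p<L p'<L P≡P' , b≡b'

  vertical-unique : ∀ {c d c' d' : Layer} {w w' : Vertex m} → SameEdge (layer c w , layer d w) (layer c' w' , layer d' w') →
                    w ≡ w' × ((c ≡ c' × d ≡ d') ⊎ (c ≡ d' × d ≡ c'))
  vertical-unique same with SameEdge-layer⁻ same
  ... | inj₁ ((c≡c' , w≡w') , (d≡d' , _)) = w≡w' , inj₁ (c≡c' , d≡d')
  ... | inj₂ ((c≡d' , w≡w') , (d≡c' , _)) = w≡w' , inj₂ (c≡d' , d≡c')

  horizontal≢vertical : ∀ {b c d : Layer} {x y z z' : Vertex m} →
                        SameEdge (layer b x , layer b y) (layer c z , layer d z') → c ≡ d
  horizontal≢vertical same with SameEdge-layer⁻ same
  ... | inj₁ ((b≡c , _) , (b≡d , _)) = trans (sym b≡c) b≡d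
  ... | inj₂ ((b≡d , _) , (b≡c , _)) = trans (sym b≡c) b≡d

  rising-layers : ∀ {a a'} → (a ≡ a' × next a ≡ next a') ⊎ (a ≡ next a' × next a ≡ a') → a ≡ a'
  rising-layers (inj₁ (a≡a' , _)) = a≡a'
  rising-layers (inj₂ (refl , eq)) = contradiction eq (next-next-≢ _)

  falling-layers : ∀ {a a'} → (next a ≡ next a' × a ≡ a') ⊎ (next a ≡ a' × a ≡ next a') → a ≡ a'
  falling-layers (inj₁ (_ , a≡a')) = a≡a'
  falling-layers (inj₂ (eq , refl)) = contradiction eq (next-next-≢ _)

  marked-incident : ∀ {i p} (marked : Walk.Marked i p) {w} → w ≡ v i p ⊎ w ≡ v i (suc p) →
                    Incident w (edgeAt (C i) (mk i (proj₁ marked)))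
  marked-incident {i} (j , e) (inj₁ eq) = inj₁ (trans eq (v-marked i e))
  marked-incident {i} (j , e) (inj₂ eq) = inj₂ (trans eq (v-suc-marked i e))

  marked-vertex-unique : ∀ {i i' p p'} → Walk.Marked i p → Walk.Marked i' p' → ∀ {w} →
    w ≡ v i p ⊎ w ≡ v i (suc p) → w ≡ v i' p' ⊎ w ≡ v i' (suc p') → i ≡ i' × p ≡ p'
  marked-vertex-unique marked@(j , e) marked'@(j' , e') w∈ w∈'
    with marked-edges-disjoint (marked-incident marked w∈) (marked-incident marked' w∈')
  ... | refl , mk≡mk' = refl , trans (sym e) (trans (cong toℕ mk≡mk') e')

  legEdge-unique : ∀ {i i' a a' x x'} (leg : Walk.Leg i x) (leg' : Walk.Leg i' x') → proj₁ x < L → proj₁ x' < L →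
                   SameEdge (legEdge i a leg) (legEdge i' a' leg') → i ≡ i' × a ≡ a' × x ≡ x'
  legEdge-unique (Walk.stay _) (Walk.stay _) p<L p'<L same with horizontal-unique p<L p'<L same
  ... | i≡i' , refl , a≡a' = i≡i' , a≡a' , refl
  legEdge-unique (Walk.stay ¬m) (Walk.cross m) p<L p'<L same with horizontal-unique p<L p'<L same
  ... | refl , refl , _ = contradiction m ¬m
  legEdge-unique (Walk.cross m) (Walk.stay ¬m) p<L p'<L same with horizontal-unique p<L p'<L same
  ... | refl , refl , _ = contradiction m ¬m
  legEdge-unique (Walk.cross _) (Walk.cross _) p<L p'<L same with horizontal-unique p<L p'<L same
  ... | i≡i' , refl , next≡ = i≡i' , next-injective next≡ , refl
  legEdge-unique (Walk.stay _)  (Walk.rise _) _ _ same = contradiction (horizontal≢vertical same) (next-≢ _)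
  legEdge-unique (Walk.stay _)  (Walk.fall _) _ _ same = contradiction (sym (horizontal≢vertical same)) (next-≢ _)
  legEdge-unique (Walk.cross _) (Walk.rise _) _ _ same = contradiction (horizontal≢vertical same) (next-≢ _)
  legEdge-unique (Walk.cross _) (Walk.fall _) _ _ same = contradiction (sym (horizontal≢vertical same)) (next-≢ _)
  legEdge-unique (Walk.rise _) (Walk.stay _)  _ _ same = contradiction (horizontal≢vertical (SameEdge-sym same)) (next-≢ _)
  legEdge-unique (Walk.fall _) (Walk.stay _)  _ _ same = contradiction (sym (horizontal≢vertical (SameEdge-sym same))) (next-≢ _)
  legEdge-unique (Walk.rise _) (Walk.cross _) _ _ same = contradiction (horizontal≢vertical (SameEdge-sym same)) (next-≢ _)
  legEdge-unique (Walk.fall _) (Walk.cross _) _ _ same = contradiction (sym (horizontal≢vertical (SameEdge-sym same))) (next-≢ _)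
  legEdge-unique (Walk.rise m) (Walk.rise m') _ _ same with vertical-unique same
  ... | w≡w' , layers with marked-vertex-unique m m' (inj₁ refl) (inj₁ w≡w')
  ...   | refl , refl = refl , rising-layers layers , refl
  legEdge-unique (Walk.fall m) (Walk.fall m') _ _ same with vertical-unique same
  ... | w≡w' , layers with marked-vertex-unique m m' (inj₂ refl) (inj₂ w≡w')
  ...   | refl , refl = refl , falling-layers layers , refl
  legEdge-unique {i} (Walk.rise m) (Walk.fall m') _ _ same with vertical-unique same
  ... | w≡w' , _ with marked-vertex-unique m m' (inj₁ refl) (inj₂ w≡w')
  ...   | refl , refl = contradiction w≡w' (marked-ends-differ i m m')
  legEdge-unique {i} (Walk.fall m) (Walk.rise m') _ _ same with vertical-unique same
  ... | w≡w' , _ with marked-vertex-unique m m' (inj₂ refl) (inj₁ w≡w')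
  ...   | refl , refl = contradiction (sym w≡w') (marked-ends-differ i m' m)

  Z-edge-unique : ∀ {i i' a a' q q'} → SameEdge (edgeAt (Z i a) q) (edgeAt (Z i' a') q') → i ≡ i' × a ≡ a' × q ≡ q'
  Z-edge-unique {i} {i'} {a} {a'} {q} {q'} same =
    conclude (legEdge-unique (legAt i q) (legAt i' q') (stateAt-< i q) (stateAt-< i' q')
                             (subst₂ SameEdge (Z-edge i a q) (Z-edge i' a' q') same))
    where
    conclude : i ≡ i' × a ≡ a' × stateAt i q ≡ stateAt i' q' → i ≡ i' × a ≡ a' × q ≡ q'
    conclude (refl , a≡a' , x≡x') = refl , a≡a' , stateAt-injective i x≡x'

  markZ : Fin s → Fin r → Fin Ln
  markZ i j = slot i (Walk.cross (j , refl)) (toℕ<n (mk i j))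

  stateAt-markZ : ∀ i j → stateAt i (markZ i j) ≡ (toℕ (mk i j) , lifted)
  stateAt-markZ i j = stateAt-slot i (Walk.cross (j , refl)) (toℕ<n (mk i j))

  markZ-injective : ∀ i → Injective _≡_ _≡_ (markZ i)
  markZ-injective i {j} {j'} eq = mk-injective i (toℕ-injective (cong proj₁
    (trans (sym (stateAt-markZ i j)) (trans (cong (stateAt i) eq) (stateAt-markZ i j')))))

  unlifted-unmarked : ∀ i {x} (leg : Walk.Leg i x) p<L → proj₂ x ≢ lifted → ∀ j → markZ i j ≢ slot i leg p<L
  unlifted-unmarked i leg p<L unlifted j eq =
    unlifted (cong proj₂ (trans (sym (stateAt-slot i leg p<L)) (trans (cong (stateAt i) (sym eq)) (stateAt-markZ i j))))

  module Lifted (i : Fin s) (a : Layer) (j : Fin r) = LiftedPath a (Paths.P i j)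

  Q : Fin s → Layer → Fin r → Path n (suc m)
  Q i a j = Lifted.liftedPath i a j

  Q-disjoint : ∀ i a j j' → j ≢ j' → ∀ x x' → pvtx (Q i a j) x ≢ pvtx (Q i a j') x'
  Q-disjoint i a j j' j≢j' x x' eq = Paths.paths-disjoint i j j' j≢j' _ _ (proj₂ (layer-injective eq))

  OnQ : Fin s → Layer → Pair n → Set
  OnQ i a e = Σ (Fin r) λ j → Σ (Fin (suc m)) λ t → SameEdge e (pedge (Q i a j) t)

  on-Q : ∀ i a j {t} (b : Boundary t) {e} → SameEdge e (Lifted.liftedEdge i a j b) → OnQ i a e
  on-Q i a j {t} b same = j , t , subst (SameEdge _) (sym (Lifted.liftedVertex-edge i a j b)) same

  vertical-on-Q : ∀ i a {w} → Paths.IsPathEnd i w →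
    OnQ i a (layer a w , layer (next a) w) × OnQ i a (layer (next a) w , layer a w)
  vertical-on-Q i a (j , inj₁ refl) = on-Q i a j start SameEdge-swap , on-Q i a j start SameEdge-refl
  vertical-on-Q i a (j , inj₂ refl) = on-Q i a j end SameEdge-refl , on-Q i a j end SameEdge-swap

  leg-on-Q : ∀ i a {x} (leg : Walk.Leg i x) → proj₁ x < L → (∀ {p} → Walk.Marked i p → x ≢ (p , lifted)) →
             OnQ i a (legEdge i a leg)
  leg-on-Q i a (Walk.stay {p} ¬m) p<L _ with Paths.unmarked⇒on-path i (p mod L) (unmarked-mod i p<L ¬m)
  ... | j , t , same = on-Q i a j (inner t) (SameEdge-layer a (subst (λ y → SameEdge (v i p , y) _) (sym (v-suc i p)) same))
  leg-on-Q i a (Walk.rise m) _ _ = proj₁ (vertical-on-Q i a (Paths.marked-end⇒path-end i (marked-incident m (inj₁ refl))))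
  leg-on-Q i a (Walk.fall m) _ _ = proj₂ (vertical-on-Q i a (Paths.marked-end⇒path-end i (marked-incident m (inj₂ refl))))
  leg-on-Q i a (Walk.cross m) _ not-lifted = contradiction refl (not-lifted m)

  unmarked-Z-on-Q : ∀ i a q → (∀ j → markZ i j ≢ q) → OnQ i a (edgeAt (Z i a) q)
  unmarked-Z-on-Q i a q unmarked = subst (OnQ i a) (sym (Z-edge i a q)) (leg-on-Q i a (legAt i q) (stateAt-< i q) not-lifted)
    where
    not-lifted : ∀ {p} → Walk.Marked i p → stateAt i q ≢ (p , lifted)
    not-lifted (j , e) eq = unmarked j (stateAt-injective i (trans (stateAt-markZ i j) (trans (cong (_, lifted) e) (sym eq))))

  UnmarkedZ : Fin s → Layer → Pair n → Set
  UnmarkedZ i a e = Σ (Fin Ln) λ q → (∀ j → markZ i j ≢ q) × SameEdge (edgeAt (Z i a) q) e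

  at-unlifted-leg : ∀ i a {x} (leg : Walk.Leg i x) p<L → proj₂ x ≢ lifted →
                    ∀ {e} → SameEdge (legEdge i a leg) e → UnmarkedZ i a e
  at-unlifted-leg i a leg p<L unlifted {e} same =
    slot i leg p<L , unlifted-unmarked i leg p<L unlifted , subst (λ e' → SameEdge e' e) (sym (edge-at-slot i a leg p<L)) same

  marked-end-vertical : ∀ i a {w} j₀ → Incident w (edgeAt (C i) (mk i j₀)) →
    UnmarkedZ i a (layer a w , layer (next a) w) × UnmarkedZ i a (layer (next a) w , layer a w)
  marked-end-vertical i a j₀ (inj₁ refl) = rise-at SameEdge-refl , rise-at SameEdge-swap
    where
    w = vtx (C i) (mk i j₀)
    rise-at : ∀ {e} → SameEdge (layer a w , layer (next a) w) e → UnmarkedZ i a e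
    rise-at {e} = at-unlifted-leg i a (Walk.rise (j₀ , refl)) (toℕ<n (mk i j₀)) (λ ())
                ∘ subst (λ y → SameEdge (layer a y , layer (next a) y) e) (sym (v-toℕ i (mk i j₀)))
  marked-end-vertical i a j₀ (inj₂ refl) = fall-at SameEdge-swap , fall-at SameEdge-refl
    where
    w = vtx (C i) (csuc (mk i j₀))
    fall-at : ∀ {e} → SameEdge (layer (next a) w , layer a w) e → UnmarkedZ i a e
    fall-at {e} = at-unlifted-leg i a (Walk.fall (j₀ , refl)) (toℕ<n (mk i j₀)) (λ ())
                ∘ subst (λ y → SameEdge (layer (next a) y , layer a y) e) (sym (v-suc-toℕ i (mk i j₀)))

  Q-edge-unmarked : ∀ i a j t → UnmarkedZ i a (pedge (Q i a j) t)
  Q-edge-unmarked i a j t = subst (UnmarkedZ i a) (sym (Lifted.liftedVertex-edge i a j (boundary t))) (on-boundary (boundary t))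
    where
    on-boundary : ∀ {t} (b : Boundary t) → UnmarkedZ i a (Lifted.liftedEdge i a j b)
    on-boundary start = proj₂ (uncurry (marked-end-vertical i a) (Paths.first⇒marked-end i j))
    on-boundary end   = proj₁ (uncurry (marked-end-vertical i a) (Paths.last⇒marked-end i j))
    on-boundary (inner u) = along (Paths.on-path⇒unmarked i j u)
      where
      along : Σ (Fin L) (λ O → (∀ j' → mk i j' ≢ O) × SameEdge (edgeAt (C i) O) (pedge (Paths.P i j) u)) →
              UnmarkedZ i a (Lifted.liftedEdge i a j (inner u))
      along (O , unmarked , same) =
        at-unlifted-leg i a (Walk.stay λ (j' , e) → unmarked j' (toℕ-injective e)) (toℕ<n O) (λ ())
          (SameEdge-layer a (subst (λ e → SameEdge e (pedge (Paths.P i j) u)) (cycle-edge-toℕ i O) same))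

  Z-leaves : ∀ i a → LeavesPaths (Z i a) (markZ i) (suc m)
  Z-leaves i a = Q i a , Q-disjoint i a , unmarked-Z-on-Q i a , Q-edge-unmarked i a

  markedEdge : Fin s → Layer → Fin r → Pair n
  markedEdge i a j = layer (next a) (vtx (C i) (mk i j)) , layer (next a) (vtx (C i) (csuc (mk i j)))

  Z-marked-edge : ∀ i a j → edgeAt (Z i a) (markZ i j) ≡ markedEdge i a j
  Z-marked-edge i a j = trans (edge-at-slot i a (Walk.cross (j , refl)) (toℕ<n (mk i j)))
    (cong₂ (λ x y → layer (next a) x , layer (next a) y) (v-toℕ i (mk i j)) (v-suc-toℕ i (mk i j)))

  -- The witness layer is prev α, so that the lifted matching edge at x lies in layer next (prev α) = α.
  markedEdge-covers : ∀ w → Σ (Fin s) λ i → Σ Layer λ a → Σ (Fin r) λ j → Incident w (markedEdge i a j)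
  markedEdge-covers (b ∷ c ∷ x) with proj₁ matching x
  ... | (i , j) , inc = i , prev α , j ,
    subst₂ (λ w β → Incident w (layer β (vtx (C i) (mk i j)) , layer β (vtx (C i) (csuc (mk i j)))))
           (layer-layerOf b c x) (sym (next-prev α)) (Incident-layer α inc)
    where α = layerOf b c

  markedEdge-unique : ∀ {i a j i' a' j' w} → Incident w (markedEdge i a j) → Incident w (markedEdge i' a' j') →
                      SameEdge (markedEdge i a j) (markedEdge i' a' j')
  markedEdge-unique {i} {a} {j} {i'} {a'} {j'} inc inc'
    with Incident-layer⁻ (next a) inc | Incident-layer⁻ (next a') inc'
  ... | x , refl , inc-x | x' , w≡ , inc-x' with layer-injective w≡
  ...   | next≡ , refl =
    subst (λ β → SameEdge (markedEdge i a j) (layer β (vtx (C i') (mk i' j')) , layer β (vtx (C i') (csuc (mk i' j')))))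
          next≡
                           (SameEdge-layer (next a) (proj₂ matching (i , j) (i' , j') x inc-x inc-x'))

  liftedDecomposition : GoodDecomposition n r (4 * s)
  liftedDecomposition =
    Indexed.F′ , markZ ∘ Indexed.row ,
    Indexed.decomposition edge-covered Z-edge-unique ,
    markZ-injective ∘ Indexed.row ,
    (λ z → Z-leaves (Indexed.row z) (Indexed.column z)) ,
    Indexed.matching markZ markedEdge Z-marked-edge markedEdge-covers markedEdge-unique _ (λ _ _ → refl)

lift : ∀ {k r s} → GoodDecomposition (suc (suc k)) (suc r) s → GoodDecomposition (suc (suc (suc (suc k)))) (suc r) (4 * s)
lift (C , mk , decomposition , mk-injective , leaves , matching) =
  Lift.liftedDecomposition C mk decomposition mk-injective leaves matching

theorem4p1 : (n r s : ℕ) → 2 ∣ n → 6 ≤ n → 1 ≤ r →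
    GoodDecomposition (n ∸ 2) r s → GoodDecomposition n r (4 * s)
theorem4p1 _ (suc r) s _ (s≤s (s≤s (s≤s (s≤s _)))) _ = lift
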